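{- Let $q$ be a prime power and $k>1$ an integer. Let $\Pi = PG(2,q^k)$ be the Desarguesian projective plane over $\mathbb{F}_{q^k}$ and $\pi = PG(2,q)$ a subplane of $\Pi$ (over the subfield $\mathbb{F}_q$). Choose a point $D$ of $\pi$, let $\mathcal{S}$ be the set of lines of $\Pi$ of the form $\overline{Dp}$ with $p$ a point of $\pi$ different from $D$, let $\mathcal{P}=\bigcup\mathcal{S}$ (the set of points of $\Pi$ lying on some line of $\mathcal{S}$), and let $\mathcal{O}$ be the set of restrictions $L\cap\mathcal{P}$ of the lines $L$ of $\Pi$ not containing $D$. Let $R(q,q^k)$ be the incidence structure with point set $\mathcal{P}$ and line set $\mathcal{S}\cup\mathcal{O}$ (the pseudo-projective rectangle). Then the graph whose vertices are the elements of $\mathcal{O}$ (the ordinary lines), two being adjacent iff they have a common point in $\mathcal{P}$, is isomorphic to the bilinear forms graph $H_q(2,k)$.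
   Context: For a prime power $q$ and positive integer $k$, the bilinear forms graph $H_q(2,k)$ has as vertices all $2\times k$ matrices over $\mathbb{F}_q$, two matrices being adjacent iff their difference has rank $1$. -}

module Defs where

open import Level using (0ℓ)
import Data.Nat
open import Data.Nat using (ℕ; suc; _^_)
open import Data.Nat.Primality using (Prime)
open import Data.Fin using (Fin)
import Data.Fin as Fin

f0 f1 f2 : Fin 3
f0 = Fin.zero
f1 = Fin.suc Fin.zero
f2 = Fin.suc (Fin.suc Fin.zero)
open import Data.Product using (Σ; ∃; ∃-syntax; _×_; _,_; proj₁; proj₂)
open import Relation.Nullary using (¬_)
open import Relation.Binary.Bundles using (Setoid)
import Relation.Binary.PropositionalEquality as ≡
open import Function.Base using (_∘_)
open import Function.Bundles using (Bijection; _⇔_; mk⇔; Equivalence)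
open import Algebra.Bundles using (CommutativeRing)
open import Algebra.Morphism.Structures using (module RingMorphisms)

IsPrimePower : ℕ → Set
IsPrimePower q = ∃[ p ] ∃[ e ] (Prime p × q ≡.≡ p ^ suc e)

module _ (R : CommutativeRing 0ℓ 0ℓ) where
  open CommutativeRing R

  IsField : Set
  IsField = (¬ (1# ≈ 0#)) × (∀ x → ¬ (x ≈ 0#) → ∃[ y ] (x * y ≈ 1#))

  HasCard : ℕ → Set
  HasCard n = Bijection setoid (≡.setoid (Fin n))

IsFieldEmbedding : (F K : CommutativeRing 0ℓ 0ℓ) →
                   (CommutativeRing.Carrier F → CommutativeRing.Carrier K) → Set
IsFieldEmbedding F K ι =
  RingMorphisms.IsRingMonomorphism (CommutativeRing.rawRing F) (CommutativeRing.rawRing K) ι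

-- Points and lines are both nonzero vectors in K³ (taken up to
-- proportionality); point x lies on line ℓ iff ℓ₀x₀ + ℓ₁x₁ + ℓ₂x₂ = 0.

module PG2 (K : CommutativeRing 0ℓ 0ℓ) where
  open CommutativeRing K

  NonZeroVec : (Fin 3 → Carrier) → Set
  NonZeroVec v = ¬ (∀ i → v i ≈ 0#)

  Point : Set
  Point = Σ (Fin 3 → Carrier) NonZeroVec

  Line : Set
  Line = Σ (Fin 3 → Carrier) NonZeroVec

  _∼_ : Point → Point → Set
  (u , _) ∼ (v , _) = ∃[ c ] (∀ i → u i ≈ c * v i)

  dot : (Fin 3 → Carrier) → (Fin 3 → Carrier) → Carrier
  dot a b = a f0 * b f0 + (a f1 * b f1 + a f2 * b f2)

  _I_ : Point → Line → Set
  (x , _) I (ℓ , _) = dot ℓ x ≈ 0#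

module Rectangle (F K : CommutativeRing 0ℓ 0ℓ)
                 (ι : CommutativeRing.Carrier F → CommutativeRing.Carrier K)
                 (D : PG2.Point K) where
  open PG2 K
  private module K = CommutativeRing K

  InSubplane : Point → Set
  InSubplane (x , _) = Σ (Fin 3 → CommutativeRing.Carrier F) λ w → ∃[ c ] (∀ i → x i K.≈ c K.* ι (w i))

  InS : Line → Set
  InS ℓ = Σ Point λ p → (InSubplane p × ¬ (p ∼ D) × D I ℓ × p I ℓ)

  InP : Point → Set
  InP x = Σ Line λ ℓ → (InS ℓ × x I ℓ)

  -- 𝒪: restrictions L ∩ 𝒫 of lines L of Π not containing D.
  -- A vertex is represented by such a line L; two are equal iff their
  -- restrictions to 𝒫 coincide as point sets.
  OLine : Set
  OLine = Σ Line (λ L → ¬ (D I L))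

  _≈O_ : OLine → OLine → Set
  (L , _) ≈O (M , _) = ∀ x → InP x → (x I L ⇔ x I M)

  OSetoid : Setoid 0ℓ 0ℓ
  OSetoid = record
    { Carrier = OLine
    ; _≈_ = _≈O_
    ; isEquivalence = record
      { refl = λ x _ → mk⇔ (λ z → z) (λ z → z)
      ; sym = λ e x px → mk⇔ (Equivalence.from (e x px)) (Equivalence.to (e x px))
      ; trans = λ e f x px → mk⇔ (Equivalence.to (f x px) ∘ Equivalence.to (e x px))
                                 (Equivalence.from (e x px) ∘ Equivalence.from (f x px))
      }
    }

  AdjO : OLine → OLine → Set
  AdjO A B = ¬ (A ≈O B) × Σ Point λ x → (InP x × x I proj₁ A × x I proj₁ B)

module Bilinear (F : CommutativeRing 0ℓ 0ℓ) (k : ℕ) where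
  open CommutativeRing F

  Mat : Set
  Mat = Fin 2 → Fin k → Carrier

  MatSetoid : Setoid 0ℓ 0ℓ
  MatSetoid = record
    { Carrier = Mat
    ; _≈_ = λ M N → ∀ i j → M i j ≈ N i j
    ; isEquivalence = record
      { refl = λ i j → refl
      ; sym = λ e i j → sym (e i j)
      ; trans = λ e f i j → trans (e i j) (f i j)
      }
    }

  _-M_ : Mat → Mat → Mat
  (M -M N) i j = M i j - N i j

  -- rank of a 2×k matrix equals 1: it is nonzero and its two rows are
  -- linearly dependent (row space has dimension exactly 1)
  RankOne : Mat → Set
  RankOne M = ¬ (∀ i j → M i j ≈ 0#)
            × ∃[ a ] ∃[ b ] (¬ (a ≈ 0# × b ≈ 0#)
                              × (∀ j → a * M Fin.zero j + b * M (Fin.suc Fin.zero) j ≈ 0#))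

  AdjH : Mat → Mat → Set
  AdjH M N = RankOne (M -M N)

-- Choose projective coordinates in which D = (0 : 0 : 1), using a permutation and a shear with
-- coefficients in F, so that π remains the set of F-rational points. A line of Π not through D
-- is then Z + aX + bY = 0 for a unique (a, b) ∈ K², and a point (X : Y : Z) lies in 𝒫 exactly
-- when (X, Y) is a K-multiple of a nonzero vector of F² (the direction of the line of 𝒮
-- through it). Testing on the points (1 : 0 : −a) and (0 : 1 : −b) of 𝒫 shows that the
-- restriction of the line to 𝒫 determines (a, b). Two ordinary lines (a, b) and (a′, b′) meet
-- in 𝒫 iff α(a − a′) + β(b − b′) = 0 for some nonzero (α, β) ∈ F², the common point being
-- (α : β : −(aα + bβ)). Since |K| = |F|^k, K has an F-basis of size k; in these coordinates
-- (a, b) becomes a 2 × k matrix over F, and the condition says that the difference of the two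
-- matrices has rank one.

module Submission where

open import Defs
open import Level using (Level; 0ℓ)
open import Algebra.Bundles using (CommutativeRing)
open import Algebra.Morphism.Structures using (module RingMorphisms)
import Algebra.Properties.Ring
import Algebra.Solver.Ring
import Algebra.Solver.Ring.AlmostCommutativeRing as ACR
open import Data.Empty using (⊥-elim)
open import Data.Fin using (Fin; zero; suc)
import Data.Fin as Fin
import Data.Fin.Properties as Fin
open import Data.Fin.Patterns using (0F; 1F; 2F)
open import Data.Fin.Permutation using (Permutation; _⟨$⟩ʳ_; _⟨$⟩ˡ_; transpose; inverseˡ; inverseʳ)
open import Data.Integer as ℤ using (ℤ; +_; -[1+_])
import Data.Integer.Properties as ℤ
open import Data.Maybe using (Maybe; just; nothing)
open import Data.Nat using (ℕ; _<_; _≤_; _^_; s≤s; z≤n)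
import Data.Nat as ℕ
import Data.Nat.Properties as ℕ
open import Data.Product using (Σ; _×_; _,_; proj₁; proj₂; ∃-syntax)
import Data.Sign as Sign
open import Data.Sum using (_⊎_; inj₁; inj₂)
open import Data.Vec.Functional using (_∷_; [])
open import Function.Base using (_∘_)
open import Function.Bundles using (Bijection; Inverse; _⇔_; mk⇔; Equivalence)
open import Function.Properties.Bijection using (Bijection⇒Inverse)
open import Relation.Binary.Bundles using (Setoid)
open import Relation.Binary.Definitions using (Decidable)
import Relation.Binary.PropositionalEquality as ≡
open ≡ using (_≡_)
import Relation.Binary.Reasoning.Setoid as SetoidReasoning
open import Relation.Nullary using (¬_; Dec; yes; no)
open import Relation.Nullary.Decidable using (via-injection)

-- Algebra.Solver.Ring normalises coefficients by computation, so it needs a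
-- concrete coefficient ring: ℤ, mapped into R. The TCOptimised multiples make
-- fromℤ (+ 1) reduce to 1#, so the constant con (+ 1) of an identity is 1#.
module IntegerSolver {c ℓ : Level} (R : CommutativeRing c ℓ) where
  open CommutativeRing R
  open import Algebra.Properties.Semiring.Mult.TCOptimised semiring using (×-homo-+; ×1-homo-*; 1+×) renaming (_×_ to _·_)
  open import Algebra.Properties.Ring ring using (-‿+-comm; -‿involutive; -0#≈0#; -1*x≈-x; -‿distribʳ-*)
  open import Algebra.Properties.CommutativeSemigroup *-commutativeSemigroup using (interchange)
  open SetoidReasoning setoid

  fromℕ : ℕ.ℕ → Carrier
  fromℕ n = n · 1#

  fromℤ : ℤ → Carrier
  fromℤ (+ n)    = fromℕ n
  fromℤ -[1+ n ] = - fromℕ (ℕ.suc n)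

  fromSign : Sign.Sign → Carrier
  fromSign Sign.+ = 1#
  fromSign Sign.- = - 1#

  private
    x-y≈[1+x]-[1+y] : ∀ x y → x - y ≈ (1# + x) - (1# + y)
    x-y≈[1+x]-[1+y] x y = begin
      x - y                       ≈⟨ +-identityˡ _ ⟨
      0# + (x - y)                ≈⟨ +-congʳ (-‿inverseʳ 1#) ⟨
      (1# - 1#) + (x - y)         ≈⟨ +-assoc 1# (- 1#) (x - y) ⟩
      1# + (- 1# + (x - y))       ≈⟨ +-congˡ (+-assoc (- 1#) x (- y)) ⟨
      1# + ((- 1# + x) - y)       ≈⟨ +-congˡ (+-congʳ (+-comm (- 1#) x)) ⟩
      1# + ((x - 1#) - y)         ≈⟨ +-congˡ (+-assoc x (- 1#) (- y)) ⟩
      1# + (x + (- 1# - y))       ≈⟨ +-congˡ (+-congˡ (-‿+-comm 1# y)) ⟩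
      1# + (x - (1# + y))         ≈⟨ +-assoc 1# x _ ⟨
      (1# + x) - (1# + y)         ∎

  fromℤ-⊖ : ∀ m n → fromℤ (m ℤ.⊖ n) ≈ fromℕ m - fromℕ n
  fromℤ-⊖ m ℕ.zero = sym (trans (+-congˡ -0#≈0#) (+-identityʳ (fromℕ m)))
  fromℤ-⊖ ℕ.zero (ℕ.suc n) = sym (+-identityˡ _)
  fromℤ-⊖ (ℕ.suc m) (ℕ.suc n) = begin
    fromℤ (ℕ.suc m ℤ.⊖ ℕ.suc n)  ≡⟨ ≡.cong fromℤ (ℤ.[1+m]⊖[1+n]≡m⊖n m n) ⟩
    fromℤ (m ℤ.⊖ n)              ≈⟨ fromℤ-⊖ m n ⟩
    fromℕ m - fromℕ n            ≈⟨ x-y≈[1+x]-[1+y] (fromℕ m) (fromℕ n) ⟩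
    (1# + fromℕ m) - (1# + fromℕ n) ≈⟨ +-cong (1+× m 1#) (-‿cong (1+× n 1#)) ⟨
    fromℕ (ℕ.suc m) - fromℕ (ℕ.suc n) ∎

  fromℤ-+ : ∀ i j → fromℤ (i ℤ.+ j) ≈ fromℤ i + fromℤ j
  fromℤ-+ (+ m)    (+ n)    = ×-homo-+ 1# m n
  fromℤ-+ (+ m)    -[1+ n ] = fromℤ-⊖ m (ℕ.suc n)
  fromℤ-+ -[1+ m ] (+ n)    = trans (fromℤ-⊖ n (ℕ.suc m)) (+-comm _ _)
  fromℤ-+ -[1+ m ] -[1+ n ] = begin
    - fromℕ (ℕ.suc (ℕ.suc (m ℕ.+ n)))     ≡⟨ ≡.cong (λ t → - fromℕ (ℕ.suc t)) (≡.sym (ℕ.+-suc m n)) ⟩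
    - fromℕ (ℕ.suc m ℕ.+ ℕ.suc n)         ≈⟨ -‿cong (×-homo-+ 1# (ℕ.suc m) (ℕ.suc n)) ⟩
    - (fromℕ (ℕ.suc m) + fromℕ (ℕ.suc n)) ≈⟨ -‿+-comm _ _ ⟨
    - fromℕ (ℕ.suc m) - fromℕ (ℕ.suc n)   ∎

  fromSign-* : ∀ s t → fromSign (s Sign.* t) ≈ fromSign s * fromSign t
  fromSign-* Sign.+ Sign.+ = sym (*-identityˡ _)
  fromSign-* Sign.+ Sign.- = sym (*-identityˡ _)
  fromSign-* Sign.- Sign.+ = sym (*-identityʳ _)
  fromSign-* Sign.- Sign.- = begin
    1#             ≈⟨ -‿involutive 1# ⟨
    - - 1#         ≈⟨ -‿cong (-1*x≈-x 1#) ⟨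
    - (- 1# * 1#)  ≈⟨ -‿distribʳ-* (- 1#) 1# ⟩
    - 1# * - 1#    ∎

  fromℤ-◃ : ∀ s n → fromℤ (s ℤ.◃ n) ≈ fromSign s * fromℕ n
  fromℤ-◃ s       ℕ.zero    = sym (zeroʳ (fromSign s))
  fromℤ-◃ Sign.+ (ℕ.suc n) = sym (*-identityˡ _)
  fromℤ-◃ Sign.- (ℕ.suc n) = sym (-1*x≈-x _)

  fromℤ≈sign*abs : ∀ i → fromℤ i ≈ fromSign (ℤ.sign i) * fromℕ ℤ.∣ i ∣
  fromℤ≈sign*abs (+ n)    = sym (*-identityˡ _)
  fromℤ≈sign*abs -[1+ n ] = sym (-1*x≈-x _)

  fromℤ-* : ∀ i j → fromℤ (i ℤ.* j) ≈ fromℤ i * fromℤ j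
  fromℤ-* i j = begin
    fromℤ (i ℤ.* j)
      ≈⟨ fromℤ-◃ (ℤ.sign i Sign.* ℤ.sign j) (ℤ.∣ i ∣ ℕ.* ℤ.∣ j ∣) ⟩
    fromSign (ℤ.sign i Sign.* ℤ.sign j) * fromℕ (ℤ.∣ i ∣ ℕ.* ℤ.∣ j ∣)
      ≈⟨ *-cong (fromSign-* (ℤ.sign i) (ℤ.sign j)) (×1-homo-* ℤ.∣ i ∣ ℤ.∣ j ∣) ⟩
    (fromSign (ℤ.sign i) * fromSign (ℤ.sign j)) * (fromℕ ℤ.∣ i ∣ * fromℕ ℤ.∣ j ∣)
      ≈⟨ interchange _ _ _ _ ⟩
    (fromSign (ℤ.sign i) * fromℕ ℤ.∣ i ∣) * (fromSign (ℤ.sign j) * fromℕ ℤ.∣ j ∣)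
      ≈⟨ *-cong (fromℤ≈sign*abs i) (fromℤ≈sign*abs j) ⟨
    fromℤ i * fromℤ j ∎

  fromℤ-neg : ∀ i → fromℤ (ℤ.- i) ≈ - fromℤ i
  fromℤ-neg (+ ℕ.zero)  = sym -0#≈0#
  fromℤ-neg (+ ℕ.suc n) = refl
  fromℤ-neg -[1+ n ]    = sym (-‿involutive _)

  private
    R′ : ACR.AlmostCommutativeRing c ℓ
    R′ = ACR.fromCommutativeRing R

    fromℤ-homomorphism : ℤ.+-*-rawRing ACR.-Raw-AlmostCommutative⟶ R′
    fromℤ-homomorphism = record
      { ⟦_⟧    = fromℤ
      ; +-homo = fromℤ-+
      ; *-homo = fromℤ-*
      ; -‿homo = fromℤ-neg
      ; 0-homo = refl
      ; 1-homo = refl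
      }

    fromℤ-≟ : ∀ i j → Maybe (fromℤ i ≈ fromℤ j)
    fromℤ-≟ i j with i ℤ.≟ j
    ... | yes ≡.refl = just refl
    ... | no _       = nothing

  open Algebra.Solver.Ring ℤ.+-*-rawRing R′ fromℤ-homomorphism fromℤ-≟ public
    using (solve; _:=_; _:+_; _:*_; _:-_; :-_; con)

module FiniteSetoid {S : Setoid 0ℓ 0ℓ} {n} (card : Bijection S (≡.setoid (Fin n))) where
  open Setoid S
  open Inverse (Bijection⇒Inverse card) public
    using () renaming (to to index; from to element; to-cong to index-cong;
                       strictlyInverseˡ to index-element; strictlyInverseʳ to element-index)

  element-injective : ∀ {i j} → element i ≈ element j → i ≡ j
  element-injective {i} {j} eq =
    ≡.trans (≡.sym (index-element i)) (≡.trans (index-cong eq) (index-element j))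

  index-injective : ∀ {x y} → index x ≡ index y → x ≈ y
  index-injective = Bijection.injective card

  _≟_ : Decidable _≈_
  _≟_ = via-injection (Bijection.injection card) Fin._≟_

module FieldProperties (R : CommutativeRing 0ℓ 0ℓ) (isField : IsField R)
                       (_≟_ : Decidable (CommutativeRing._≈_ R)) where
  open CommutativeRing R
  open IntegerSolver R
  open import Algebra.Properties.Ring ring using (x∙y⁻¹≈ε⇒x≈y)
  open SetoidReasoning setoid

  NotBothZero : Carrier → Carrier → Set
  NotBothZero a b = ¬ (a ≈ 0# × b ≈ 0#)

  1≉0 : ¬ 1# ≈ 0#
  1≉0 = proj₁ isField

  division : ∀ x {y} → ¬ y ≈ 0# → ∃[ z ] y * z ≈ x
  division x {y} y≉0 = y⁻¹ * x , (begin
    y * (y⁻¹ * x) ≈⟨ *-assoc y y⁻¹ x ⟨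
    (y * y⁻¹) * x ≈⟨ *-congʳ (proj₂ (proj₂ isField y y≉0)) ⟩
    1# * x        ≈⟨ *-identityˡ x ⟩
    x             ∎)
    where y⁻¹ = proj₁ (proj₂ isField y y≉0)

  x*y≈0⇒y≈0 : ∀ {x y} → ¬ x ≈ 0# → x * y ≈ 0# → y ≈ 0#
  x*y≈0⇒y≈0 {x} {y} x≉0 xy≈0 = begin
    y             ≈⟨ *-identityˡ y ⟨
    1# * y        ≈⟨ *-congʳ x*x⁻¹≈1 ⟨
    (x * x⁻¹) * y ≈⟨ solve 3 (λ a b c → (a :* b) :* c := b :* (a :* c)) refl x x⁻¹ y ⟩
    x⁻¹ * (x * y) ≈⟨ *-congˡ xy≈0 ⟩
    x⁻¹ * 0#      ≈⟨ zeroʳ x⁻¹ ⟩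
    0#            ∎
    where
    x⁻¹ = proj₁ (division 1# x≉0)
    x*x⁻¹≈1 = proj₂ (division 1# x≉0)

  private
    combination-of-zeros : ∀ a b {u v} → u ≈ 0# → v ≈ 0# → a * u - b * v ≈ 0#
    combination-of-zeros a b u≈0 v≈0 =
      trans (+-cong (trans (*-congˡ u≈0) (zeroʳ a)) (-‿cong (trans (*-congˡ v≈0) (zeroʳ b))))
            (-‿inverseʳ 0#)

  annihilated⇒proportional : ∀ {l₀ l₁ s t x y} → NotBothZero l₀ l₁ →
    l₀ * s + l₁ * t ≈ 0# → l₀ * x + l₁ * y ≈ 0# → t * x ≈ s * y
  annihilated⇒proportional {l₀} {l₁} {s} {t} {x} {y} l≉0 ls≈0 lx≈0
    with l₀ ≟ 0# | l₁ ≟ 0#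
  ... | yes l₀≈0 | yes l₁≈0 = ⊥-elim (l≉0 (l₀≈0 , l₁≈0))
  ... | no l₀≉0  | _         = x∙y⁻¹≈ε⇒x≈y _ _ (x*y≈0⇒y≈0 l₀≉0 (begin
    l₀ * (t * x - s * y)
      ≈⟨ solve 6 (λ l₀ l₁ s t x y → l₀ :* (t :* x :- s :* y)
                    := t :* (l₀ :* x :+ l₁ :* y) :- y :* (l₀ :* s :+ l₁ :* t)) refl l₀ l₁ s t x y ⟩
    t * (l₀ * x + l₁ * y) - y * (l₀ * s + l₁ * t) ≈⟨ combination-of-zeros t y lx≈0 ls≈0 ⟩
    0# ∎))
  ... | yes _    | no l₁≉0   = x∙y⁻¹≈ε⇒x≈y _ _ (x*y≈0⇒y≈0 l₁≉0 (begin
    l₁ * (t * x - s * y)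
      ≈⟨ solve 6 (λ l₀ l₁ s t x y → l₁ :* (t :* x :- s :* y)
                    := x :* (l₀ :* s :+ l₁ :* t) :- s :* (l₀ :* x :+ l₁ :* y)) refl l₀ l₁ s t x y ⟩
    x * (l₀ * s + l₁ * t) - s * (l₀ * x + l₁ * y) ≈⟨ combination-of-zeros x s ls≈0 lx≈0 ⟩
    0# ∎))

funToFin-cong : ∀ {m n} {f g : Fin m → Fin n} → (∀ i → f i ≡ g i) → Fin.funToFin f ≡ Fin.funToFin g
funToFin-cong {ℕ.zero}  f≗g = ≡.refl
funToFin-cong {ℕ.suc m} f≗g = ≡.cong₂ Fin.combine (f≗g zero) (funToFin-cong (f≗g ∘ suc))

module FiniteExtension (F K : CommutativeRing 0ℓ 0ℓ) (isFieldF : IsField F)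
  {q k : ℕ} (cardF : HasCard F q) (cardK : HasCard K (q ^ k))
  (ι : CommutativeRing.Carrier F → CommutativeRing.Carrier K)
  (ι-homomorphism : RingMorphisms.IsRingHomomorphism (CommutativeRing.rawRing F) (CommutativeRing.rawRing K) ι)
  where

  private
    module F = CommutativeRing F
    module Fᶠ = FiniteSetoid cardF
    module Kᶠ = FiniteSetoid cardK
    module FF = FieldProperties F isFieldF Fᶠ._≟_
    module ι = RingMorphisms.IsRingHomomorphism ι-homomorphism
    module Fᴿ = Algebra.Properties.Ring F.ring
  open CommutativeRing K hiding (zero)
  open Algebra.Properties.Ring ring using (-1*x≈-x; +-inverseʳ-unique; x∙y⁻¹≈ε⇒x≈y; x≈y⇒x∙y⁻¹≈ε)
  open import Algebra.Properties.Semiring.Sum semiring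
    using (sum; sum-cong-≋; ∑-distrib-+; *-distribˡ-sum; sum-replicate-zero)
  open IntegerSolver K
  open SetoidReasoning setoid

  _≋_ : ∀ {m} → (Fin m → F.Carrier) → (Fin m → F.Carrier) → Set
  c ≋ d = ∀ i → c i F.≈ d i

  combination : ∀ {m} → (Fin m → Carrier) → (Fin m → F.Carrier) → Carrier
  combination e c = sum (λ i → ι (c i) * e i)

  combination-cong : ∀ {m} (e : Fin m → Carrier) {c d} → c ≋ d → combination e c ≈ combination e d
  combination-cong e c≋d = sum-cong-≋ (λ i → *-congʳ (ι.⟦⟧-cong (c≋d i)))

  combination-zero : ∀ {m} (e : Fin m → Carrier) → combination e (λ _ → F.0#) ≈ 0#
  combination-zero {m} e = trans (sum-cong-≋ (λ i → trans (*-congʳ ι.0#-homo) (zeroˡ (e i))))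
                                 (sum-replicate-zero m)

  combination-+ : ∀ {m} (e : Fin m → Carrier) c d →
    combination e (λ i → c i F.+ d i) ≈ combination e c + combination e d
  combination-+ e c d = trans (sum-cong-≋ (λ i → trans (*-congʳ (ι.+-homo (c i) (d i))) (distribʳ (e i) _ _)))
                              (∑-distrib-+ (λ i → ι (c i) * e i) (λ i → ι (d i) * e i))

  combination-scale : ∀ {m} (e : Fin m → Carrier) α c →
    combination e (λ i → α F.* c i) ≈ ι α * combination e c
  combination-scale e α c = trans (sum-cong-≋ (λ i → trans (*-congʳ (ι.*-homo α (c i))) (*-assoc _ _ _)))
                                  (sym (*-distribˡ-sum (ι α) (λ i → ι (c i) * e i)))

  combination-linear : ∀ {m} (e : Fin m → Carrier) α β c d →
    combination e (λ i → α F.* c i F.+ β F.* d i) ≈ ι α * combination e c + ι β * combination e d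
  combination-linear e α β c d =
    trans (combination-+ e _ _) (+-cong (combination-scale e α c) (combination-scale e β d))

  combination-sub : ∀ {m} (e : Fin m → Carrier) c d →
    combination e (λ i → c i F.- d i) ≈ combination e c - combination e d
  combination-sub e c d = begin
    combination e (λ i → c i F.- d i)
      ≈⟨ combination-cong e (λ i → F.+-congˡ (F.sym (Fᴿ.-1*x≈-x (d i)))) ⟩
    combination e (λ i → c i F.+ (F.- F.1#) F.* d i)
      ≈⟨ trans (combination-+ e _ _) (+-congˡ (combination-scale e (F.- F.1#) d)) ⟩
    combination e c + ι (F.- F.1#) * combination e d
      ≈⟨ +-congˡ (*-congʳ (trans (ι.-‿homo F.1#) (-‿cong ι.1#-homo))) ⟩
    combination e c + - 1# * combination e d
      ≈⟨ +-congˡ (-1*x≈-x _) ⟩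
    combination e c - combination e d ∎

  vectorAt : ∀ {m} → Fin (q ^ m) → Fin m → F.Carrier
  vectorAt {m} i j = Fᶠ.element (Fin.finToFun {q} {m} i j)

  vectorAt-injective : ∀ {m} {i i′ : Fin (q ^ m)} → vectorAt {m} i ≋ vectorAt i′ → i ≡ i′
  vectorAt-injective {m} {i} {i′} eq =
    ≡.trans (≡.sym (Fin.funToFin-finToFin {m} {q} i))
            (≡.trans (funToFin-cong (λ j → Fᶠ.element-injective (eq j))) (Fin.funToFin-finToFin {m} {q} i′))

  vectorAt-surjective : ∀ {m} (c : Fin m → F.Carrier) → ∃[ i ] vectorAt {m} i ≋ c
  vectorAt-surjective {m} c = Fin.funToFin (Fᶠ.index ∘ c) , λ j →
    F.trans (F.reflexive (≡.cong Fᶠ.element (Fin.finToFun-funToFin {m} {q} (Fᶠ.index ∘ c) j)))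
            (Fᶠ.element-index (c j))

  Independent : ∀ {m} → (Fin m → Carrier) → Set
  Independent e = ∀ c → combination e c ≈ 0# → ∀ i → c i F.≈ F.0#

  InSpan : ∀ {m} → (Fin m → Carrier) → Carrier → Set
  InSpan {m} e x = ∃[ i ] combination e (vectorAt {m} i) ≈ x

  independent⇒injective : ∀ {m} {e : Fin m → Carrier} → Independent e →
    ∀ {c d} → combination e c ≈ combination e d → c ≋ d
  independent⇒injective {e = e} ind {c} {d} eq i = Fᴿ.x∙y⁻¹≈ε⇒x≈y _ _
    (ind (λ i → c i F.- d i) (trans (combination-sub e c d) (x≈y⇒x∙y⁻¹≈ε eq)) i)

  1<q : 1 < q
  1<q with Fᶠ.index F.0# Fin.≟ Fᶠ.index F.1#
  ... | yes eq = ⊥-elim (FF.1≉0 (F.sym (Fᶠ.index-injective eq)))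
  ... | no neq = distinct⇒1<n (Fᶠ.index F.0#) (Fᶠ.index F.1#) neq
    where
    distinct⇒1<n : ∀ {n} (a b : Fin n) → ¬ a ≡ b → 1 < n
    distinct⇒1<n {ℕ.suc ℕ.zero}     zero zero a≢b = ⊥-elim (a≢b ≡.refl)
    distinct⇒1<n {ℕ.suc (ℕ.suc n)} _    _    _   = s≤s (s≤s z≤n)

  independent⇒q^m≤q^k : ∀ {m} {e : Fin m → Carrier} → Independent e → q ^ m ≤ q ^ k
  independent⇒q^m≤q^k {m} {e} ind = Fin.injective⇒≤ {f = Kᶠ.index ∘ combination e ∘ vectorAt {m}}
    (λ eq → vectorAt-injective (independent⇒injective ind (Kᶠ.index-injective eq)))

  spanning⇒q^k≤q^m : ∀ {m} {e : Fin m → Carrier} → (∀ x → InSpan e x) → q ^ k ≤ q ^ m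
  spanning⇒q^k≤q^m {m} {e} spans = Fin.injective⇒≤ {f = λ j → proj₁ (spans (Kᶠ.element j))}
    (λ {j} {j′} eq → Kᶠ.element-injective (begin
      Kᶠ.element j                                       ≈⟨ proj₂ (spans (Kᶠ.element j)) ⟨
      combination e (vectorAt (proj₁ (spans (Kᶠ.element j))))  ≡⟨ ≡.cong (combination e ∘ vectorAt {m}) eq ⟩
      combination e (vectorAt (proj₁ (spans (Kᶠ.element j′)))) ≈⟨ proj₂ (spans (Kᶠ.element j′)) ⟩
      Kᶠ.element j′                                      ∎))

  inSpan? : ∀ {m} (e : Fin m → Carrier) x → Dec (InSpan e x)
  inSpan? {m} e x = Fin.any? (λ i → combination e (vectorAt {m} i) Kᶠ.≟ x)

  spans⊎misses : ∀ {m} (e : Fin m → Carrier) → (∀ x → InSpan e x) ⊎ ∃[ x ] ¬ InSpan e x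
  spans⊎misses e with Fin.all? (λ j → inSpan? e (Kᶠ.element j))
  ... | yes all = inj₁ (λ x → proj₁ (all (Kᶠ.index x)) , trans (proj₂ (all (Kᶠ.index x))) (Kᶠ.element-index x))
  ... | no ¬all = inj₂ (Kᶠ.element (proj₁ miss) , proj₂ miss)
    where miss = Fin.¬∀⟶∃¬ _ _ (λ j → inSpan? e (Kᶠ.element j)) ¬all

  independent-∷ : ∀ {m} {e : Fin m → Carrier} {x} → Independent e → ¬ InSpan e x → Independent (x ∷ e)
  independent-∷ {e = e} {x} ind x∉ c Σc≈0 with c zero Fᶠ.≟ F.0#
  ... | yes c₀≈0 = λ { zero → c₀≈0 ; (suc i) → ind (c ∘ suc) rest≈0 i }
    where
    rest≈0 : combination e (c ∘ suc) ≈ 0#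
    rest≈0 = begin
      combination e (c ∘ suc)                  ≈⟨ +-identityˡ _ ⟨
      0# + combination e (c ∘ suc)             ≈⟨ +-congʳ (trans (*-congʳ (trans (ι.⟦⟧-cong c₀≈0) ι.0#-homo)) (zeroˡ x)) ⟨
      ι (c zero) * x + combination e (c ∘ suc) ≈⟨ Σc≈0 ⟩
      0#                                       ∎
  ... | no c₀≉0 = ⊥-elim (x∉ (proj₁ y·c′ , trans (combination-cong e (proj₂ y·c′)) x∈span))
    where
    y = proj₁ (FF.division (F.- F.1#) c₀≉0)
    c₀y≈-1 : ι (c zero) * ι y ≈ - 1#
    c₀y≈-1 = trans (sym (ι.*-homo _ _)) (trans (ι.⟦⟧-cong (proj₂ (FF.division (F.- F.1#) c₀≉0)))
                                               (trans (ι.-‿homo F.1#) (-‿cong ι.1#-homo)))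
    y·c′ = vectorAt-surjective (λ i → y F.* c (suc i))
    x∈span : combination e (λ i → y F.* c (suc i)) ≈ x
    x∈span = begin
      combination e (λ i → y F.* c (suc i))  ≈⟨ combination-scale e y (c ∘ suc) ⟩
      ι y * combination e (c ∘ suc)          ≈⟨ *-congˡ (+-inverseʳ-unique _ _ Σc≈0) ⟩
      ι y * - (ι (c zero) * x)
        ≈⟨ solve 3 (λ a b x → b :* (:- (a :* x)) := :- ((a :* b) :* x)) refl (ι (c zero)) (ι y) x ⟩
      - ((ι (c zero) * ι y) * x)             ≈⟨ -‿cong (*-congʳ c₀y≈-1) ⟩
      - (- 1# * x)                           ≈⟨ solve 1 (λ x → :- (:- con (+ 1) :* x) := x) refl x ⟩
      x                                      ∎

  independentFamily : ∀ m → m ≤ k → Σ (Fin m → Carrier) Independent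
  independentFamily ℕ.zero    _     = (λ ()) , λ _ _ ()
  independentFamily (ℕ.suc m) 1+m≤k with independentFamily m (ℕ.≤-trans (ℕ.n≤1+n m) 1+m≤k)
  ... | e , ind with spans⊎misses e
  ... | inj₁ spans      = ⊥-elim (ℕ.<⇒≱ (ℕ.^-monoʳ-< q 1<q 1+m≤k) (spanning⇒q^k≤q^m {e = e} spans))
  ... | inj₂ (x , x∉)   = x ∷ e , independent-∷ ind x∉

  basis : Σ (Fin k → Carrier) λ e → Independent e × (∀ x → InSpan e x)
  basis with independentFamily k ℕ.≤-refl
  ... | e , ind with spans⊎misses e
  ... | inj₁ spans    = e , ind , spans
  ... | inj₂ (x , x∉) = ⊥-elim (ℕ.<⇒≱ (ℕ.^-monoʳ-< q 1<q (ℕ.n<1+n k)) (independent⇒q^m≤q^k {e = x ∷ e} (independent-∷ ind x∉)))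

  fromCoordinates : (Fin k → F.Carrier) → Carrier
  fromCoordinates = combination (proj₁ basis)

  coordinates : Carrier → Fin k → F.Carrier
  coordinates x = vectorAt (proj₁ (proj₂ (proj₂ basis) x))

  fromCoordinates-coordinates : ∀ x → fromCoordinates (coordinates x) ≈ x
  fromCoordinates-coordinates x = proj₂ (proj₂ (proj₂ basis) x)

  fromCoordinates-injective : ∀ {c d} → fromCoordinates c ≈ fromCoordinates d → c ≋ d
  fromCoordinates-injective = independent⇒injective (proj₁ (proj₂ basis))

  coordinates-cong : ∀ {x y} → x ≈ y → coordinates x ≋ coordinates y
  coordinates-cong {x} {y} x≈y = fromCoordinates-injective
    (trans (fromCoordinates-coordinates x) (trans x≈y (sym (fromCoordinates-coordinates y))))

  coordinates-injective : ∀ {x y} → coordinates x ≋ coordinates y → x ≈ y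
  coordinates-injective {x} {y} eq = begin
    x                             ≈⟨ fromCoordinates-coordinates x ⟨
    fromCoordinates (coordinates x) ≈⟨ combination-cong (proj₁ basis) eq ⟩
    fromCoordinates (coordinates y) ≈⟨ fromCoordinates-coordinates y ⟩
    y                             ∎

  coordinates-fromCoordinates : ∀ c → coordinates (fromCoordinates c) ≋ c
  coordinates-fromCoordinates c = fromCoordinates-injective (fromCoordinates-coordinates (fromCoordinates c))

  coordinates-relation : ∀ α β x x′ y y′ →
    (ι α * (x - x′) + ι β * (y - y′) ≈ 0#) ⇔
    (∀ j → α F.* (coordinates x j F.- coordinates x′ j) F.+ β F.* (coordinates y j F.- coordinates y′ j) F.≈ F.0#)
  coordinates-relation α β x x′ y y′ = mk⇔
    (λ rel → fromCoordinates-injective (trans image (trans rel (sym (combination-zero e)))))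
    (λ r≋0 → trans (sym image) (trans (combination-cong e r≋0) (combination-zero e)))
    where
    e = proj₁ basis
    image : fromCoordinates (λ j → α F.* (coordinates x j F.- coordinates x′ j)
                                    F.+ β F.* (coordinates y j F.- coordinates y′ j))
            ≈ ι α * (x - x′) + ι β * (y - y′)
    image = trans (combination-linear e α β _ _)
                  (+-cong (*-congˡ (difference x x′)) (*-congˡ (difference y y′)))
      where
      difference : ∀ u v → fromCoordinates (λ j → coordinates u j F.- coordinates v j) ≈ u - v
      difference u v = trans (combination-sub e _ _)
                             (+-cong (fromCoordinates-coordinates u) (-‿cong (fromCoordinates-coordinates v)))

module PG2Properties (R : CommutativeRing 0ℓ 0ℓ) where
  open CommutativeRing R
  open PG2 R using (dot)
  open import Algebra.Properties.Semiring.Sum semiring using (sum; ∑-permute)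

  dot-cong : ∀ {a a′ b b′} → (∀ i → a i ≈ a′ i) → (∀ i → b i ≈ b′ i) → dot a b ≈ dot a′ b′
  dot-cong a≈a′ b≈b′ = +-cong (*-cong (a≈a′ 0F) (b≈b′ 0F))
                              (+-cong (*-cong (a≈a′ 1F) (b≈b′ 1F)) (*-cong (a≈a′ 2F) (b≈b′ 2F)))

  private
    dot≈sum : ∀ a b → dot a b ≈ sum (λ i → a i * b i)
    dot≈sum a b = +-congˡ (+-congˡ (sym (+-identityʳ _)))

  dot-permute : ∀ (π : Permutation 3 3) a b → dot a b ≈ dot (a ∘ (π ⟨$⟩ʳ_)) (b ∘ (π ⟨$⟩ʳ_))
  dot-permute π a b = trans (dot≈sum a b)
    (trans (∑-permute (λ i → a i * b i) π) (sym (dot≈sum (a ∘ (π ⟨$⟩ʳ_)) (b ∘ (π ⟨$⟩ʳ_)))))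

-- For W₂ = 1, shear is a projectivity sending W to (0 : 0 : 1) and coshear is the
-- induced map on line coordinates.
module Shear (R : CommutativeRing 0ℓ 0ℓ) (W : Fin 3 → CommutativeRing.Carrier R) where
  open CommutativeRing R
  open PG2 R using (dot)
  open PG2Properties R using (dot-cong)
  open IntegerSolver R
  open SetoidReasoning setoid

  shear : (Fin 3 → Carrier) → Fin 3 → Carrier
  shear y = (y 0F - y 2F * W 0F) ∷ (y 1F - y 2F * W 1F) ∷ y 2F ∷ []

  unshear : (Fin 3 → Carrier) → Fin 3 → Carrier
  unshear v = (v 0F + v 2F * W 0F) ∷ (v 1F + v 2F * W 1F) ∷ v 2F ∷ []

  coshear : (Fin 3 → Carrier) → Fin 3 → Carrier
  coshear ℓ = ℓ 0F ∷ ℓ 1F ∷ dot ℓ W ∷ []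

  uncoshear : (Fin 3 → Carrier) → Fin 3 → Carrier
  uncoshear m = m 0F ∷ m 1F ∷ (m 2F - (m 0F * W 0F + m 1F * W 1F)) ∷ []

  shear-cong : ∀ {y z} → (∀ i → y i ≈ z i) → ∀ i → shear y i ≈ shear z i
  shear-cong y≈z 0F = +-cong (y≈z 0F) (-‿cong (*-congʳ (y≈z 2F)))
  shear-cong y≈z 1F = +-cong (y≈z 1F) (-‿cong (*-congʳ (y≈z 2F)))
  shear-cong y≈z 2F = y≈z 2F

  coshear-cong : ∀ {ℓ ℓ′} → (∀ i → ℓ i ≈ ℓ′ i) → ∀ i → coshear ℓ i ≈ coshear ℓ′ i
  coshear-cong ℓ≈ℓ′ 0F = ℓ≈ℓ′ 0F
  coshear-cong ℓ≈ℓ′ 1F = ℓ≈ℓ′ 1F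
  coshear-cong ℓ≈ℓ′ 2F = dot-cong {b = W} ℓ≈ℓ′ (λ _ → refl)

  private
    [x+y]-y≈x : ∀ x y → (x + y) - y ≈ x
    [x+y]-y≈x = solve 2 (λ x y → (x :+ y) :- y := x) refl

    [x-y]+y≈x : ∀ x y → (x - y) + y ≈ x
    [x-y]+y≈x = solve 2 (λ x y → (x :- y) :+ y := x) refl

  shear-unshear : ∀ v i → shear (unshear v) i ≈ v i
  shear-unshear v 0F = [x+y]-y≈x (v 0F) (v 2F * W 0F)
  shear-unshear v 1F = [x+y]-y≈x (v 1F) (v 2F * W 1F)
  shear-unshear v 2F = refl

  shear-scale : ∀ {y z} s → (∀ i → y i ≈ s * z i) → ∀ i → shear y i ≈ s * shear z i
  shear-scale {y} {z} s y≈sz 0F = trans (+-cong (y≈sz 0F) (-‿cong (*-congʳ (y≈sz 2F))))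
    (solve 4 (λ s a c w → s :* a :- (s :* c) :* w := s :* (a :- c :* w)) refl s (z 0F) (z 2F) (W 0F))
  shear-scale {y} {z} s y≈sz 1F = trans (+-cong (y≈sz 1F) (-‿cong (*-congʳ (y≈sz 2F))))
    (solve 4 (λ s a c w → s :* a :- (s :* c) :* w := s :* (a :- c :* w)) refl s (z 1F) (z 2F) (W 1F))
  shear-scale s y≈sz 2F = y≈sz 2F

  unshear-reflects-zero : ∀ {v} → (∀ i → unshear v i ≈ 0#) → ∀ i → v i ≈ 0#
  unshear-reflects-zero {v} v′≈0 0F = begin
    v 0F                          ≈⟨ [x+y]-y≈x (v 0F) (v 2F * W 0F) ⟨
    (v 0F + v 2F * W 0F) - v 2F * W 0F ≈⟨ +-cong (v′≈0 0F) (-‿cong (*-congʳ (v′≈0 2F))) ⟩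
    0# - 0# * W 0F                ≈⟨ solve 1 (λ w → con (+ 0) :- con (+ 0) :* w := con (+ 0)) refl (W 0F) ⟩
    0#                            ∎
  unshear-reflects-zero {v} v′≈0 1F = begin
    v 1F                          ≈⟨ [x+y]-y≈x (v 1F) (v 2F * W 1F) ⟨
    (v 1F + v 2F * W 1F) - v 2F * W 1F ≈⟨ +-cong (v′≈0 1F) (-‿cong (*-congʳ (v′≈0 2F))) ⟩
    0# - 0# * W 1F                ≈⟨ solve 1 (λ w → con (+ 0) :- con (+ 0) :* w := con (+ 0)) refl (W 1F) ⟩
    0#                            ∎
  unshear-reflects-zero v′≈0 2F = v′≈0 2F

  uncoshear-reflects-zero : ∀ {m} → (∀ i → uncoshear m i ≈ 0#) → ∀ i → m i ≈ 0#
  uncoshear-reflects-zero m′≈0 0F = m′≈0 0F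
  uncoshear-reflects-zero m′≈0 1F = m′≈0 1F
  uncoshear-reflects-zero {m} m′≈0 2F = begin
    m 2F                                  ≈⟨ [x-y]+y≈x (m 2F) _ ⟨
    uncoshear m 2F + (m 0F * W 0F + m 1F * W 1F) ≈⟨ +-cong (m′≈0 2F) (+-cong (*-congʳ (m′≈0 0F)) (*-congʳ (m′≈0 1F))) ⟩
    0# + (0# * W 0F + 0# * W 1F)          ≈⟨ solve 2 (λ a b → con (+ 0) :+ (con (+ 0) :* a :+ con (+ 0) :* b) := con (+ 0)) refl (W 0F) (W 1F) ⟩
    0#                                    ∎

  module _ (W₂≈1 : W 2F ≈ 1#) where

    dot-shear : ∀ ℓ y → dot ℓ y ≈ dot (coshear ℓ) (shear y)
    dot-shear ℓ y = begin
      ℓ 0F * y 0F + (ℓ 1F * y 1F + ℓ 2F * y 2F)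
        ≈⟨ +-congˡ (+-congˡ (*-congˡ (trans (sym (*-identityˡ (y 2F))) (*-congʳ (sym W₂≈1))))) ⟩
      ℓ 0F * y 0F + (ℓ 1F * y 1F + ℓ 2F * (W 2F * y 2F))
        ≈⟨ solve 9 (λ l₀ l₁ l₂ y₀ y₁ y₂ w₀ w₁ w₂ →
             l₀ :* y₀ :+ (l₁ :* y₁ :+ l₂ :* (w₂ :* y₂))
             := l₀ :* (y₀ :- y₂ :* w₀) :+ (l₁ :* (y₁ :- y₂ :* w₁) :+ (l₀ :* w₀ :+ (l₁ :* w₁ :+ l₂ :* w₂)) :* y₂))
             refl (ℓ 0F) (ℓ 1F) (ℓ 2F) (y 0F) (y 1F) (y 2F) (W 0F) (W 1F) (W 2F) ⟩
      dot (coshear ℓ) (shear y) ∎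

    coshear-uncoshear : ∀ m i → coshear (uncoshear m) i ≈ m i
    coshear-uncoshear m 0F = refl
    coshear-uncoshear m 1F = refl
    coshear-uncoshear m 2F = begin
      m 0F * W 0F + (m 1F * W 1F + uncoshear m 2F * W 2F) ≈⟨ +-congˡ (+-congˡ (*-congˡ W₂≈1)) ⟩
      m 0F * W 0F + (m 1F * W 1F + uncoshear m 2F * 1#)
        ≈⟨ solve 3 (λ a b c → a :+ (b :+ (c :- (a :+ b)) :* con (+ 1)) := c) refl (m 0F * W 0F) (m 1F * W 1F) (m 2F) ⟩
      m 2F ∎

    shear-W : ∀ i → shear W i ≈ (0# ∷ 0# ∷ 1# ∷ []) i
    shear-W 0F = trans (+-congˡ (-‿cong (trans (*-congʳ W₂≈1) (*-identityˡ _)))) (-‿inverseʳ _)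
    shear-W 1F = trans (+-congˡ (-‿cong (trans (*-congʳ W₂≈1) (*-identityˡ _)))) (-‿inverseʳ _)
    shear-W 2F = W₂≈1

    shear-kernel : ∀ {y} → shear y 0F ≈ 0# → shear y 1F ≈ 0# → ∀ i → y i ≈ y 2F * W i
    shear-kernel {y} y′₀≈0 y′₁≈0 0F = trans (sym ([x-y]+y≈x (y 0F) _)) (trans (+-congʳ y′₀≈0) (+-identityˡ _))
    shear-kernel {y} y′₀≈0 y′₁≈0 1F = trans (sym ([x-y]+y≈x (y 1F) _)) (trans (+-congʳ y′₁≈0) (+-identityˡ _))
    shear-kernel {y} y′₀≈0 y′₁≈0 2F = trans (sym (*-identityʳ _)) (*-congˡ (sym W₂≈1))

    coshear-reflects-zero : ∀ {ℓ} → (∀ i → coshear ℓ i ≈ 0#) → ∀ i → ℓ i ≈ 0#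
    coshear-reflects-zero ℓ′≈0 0F = ℓ′≈0 0F
    coshear-reflects-zero ℓ′≈0 1F = ℓ′≈0 1F
    coshear-reflects-zero {ℓ} ℓ′≈0 2F = begin
      ℓ 2F                                           ≈⟨ *-identityʳ _ ⟨
      ℓ 2F * 1#                                      ≈⟨ *-congˡ W₂≈1 ⟨
      ℓ 2F * W 2F                                    ≈⟨ solve 3 (λ a b c → c := con (+ 0) :* a :+ (con (+ 0) :* b :+ c)) refl (W 0F) (W 1F) (ℓ 2F * W 2F) ⟩
      0# * W 0F + (0# * W 1F + ℓ 2F * W 2F)          ≈⟨ +-cong (*-congʳ (ℓ′≈0 0F)) (+-congʳ (*-congʳ (ℓ′≈0 1F))) ⟨
      dot ℓ W                                        ≈⟨ ℓ′≈0 2F ⟩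
      0#                                             ∎

transpose-2F : ∀ (j : Fin 3) → transpose j 2F ⟨$⟩ʳ 2F ≡ j
transpose-2F 0F = ≡.refl
transpose-2F 1F = ≡.refl
transpose-2F 2F = ≡.refl

module Frame (F K : CommutativeRing 0ℓ 0ℓ) (isFieldF : IsField F) (isFieldK : IsField K)
  (_≟F_ : Decidable (CommutativeRing._≈_ F)) (_≟K_ : Decidable (CommutativeRing._≈_ K))
  (ι : CommutativeRing.Carrier F → CommutativeRing.Carrier K) (ι-monomorphism : IsFieldEmbedding F K ι)
  (D : PG2.Point K) (D∈π : Rectangle.InSubplane F K ι D D) where

  private
    module F = CommutativeRing F
    module ι = RingMorphisms.IsRingMonomorphism ι-monomorphism
    module FF = FieldProperties F isFieldF _≟F_
    module KF = FieldProperties K isFieldK _≟K_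
  open CommutativeRing K hiding (zero)
  open PG2 K
  open PG2Properties K
  open Rectangle F K ι D using (InSubplane)
  open IntegerSolver K
  open SetoidReasoning setoid

  -- New coordinates in which D = (0 : 0 : 1): a coordinate j where the F-rational
  -- representative w of D is nonzero is moved to the last place, w is scaled to
  -- W with W₂ = 1 (still F-rational), and the shear by W is applied.
  private
    w : Fin 3 → F.Carrier
    w = proj₁ D∈π

    c₀ : Carrier
    c₀ = proj₁ (proj₂ D∈π)

    D≈c₀w : ∀ i → proj₁ D i ≈ c₀ * ι (w i)
    D≈c₀w = proj₂ (proj₂ D∈π)

    w≉0 : ∃[ j ] ¬ w j F.≈ F.0#
    w≉0 = Fin.¬∀⟶∃¬ 3 _ (λ i → w i ≟F F.0#) λ w≈0 →
      proj₂ D (λ i → trans (D≈c₀w i) (trans (*-congˡ (trans (ι.⟦⟧-cong (w≈0 i)) ι.0#-homo)) (zeroʳ c₀)))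

    j : Fin 3
    j = proj₁ w≉0

    π : Permutation 3 3
    π = transpose j 2F

    wⱼ⁻¹ : F.Carrier
    wⱼ⁻¹ = proj₁ (FF.division F.1# (proj₂ w≉0))

    w′ : Fin 3 → F.Carrier
    w′ i = w (π ⟨$⟩ʳ i) F.* wⱼ⁻¹

    W : Fin 3 → Carrier
    W = ι ∘ w′

    W₂≈1 : W 2F ≈ 1#
    W₂≈1 = trans (ι.⟦⟧-cong (F.trans (F.*-congʳ (F.reflexive (≡.cong w (transpose-2F j))))
                                      (proj₂ (FF.division F.1# (proj₂ w≉0)))))
                 ι.1#-homo

    module Sᴷ = Shear K W
    module Sᶠ = Shear F w′

  coordₚ coordₗ fromCoordₚ fromCoordₗ : (Fin 3 → Carrier) → Fin 3 → Carrier
  coordₚ y     = Sᴷ.shear (y ∘ (π ⟨$⟩ʳ_))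
  coordₗ ℓ     = Sᴷ.coshear (ℓ ∘ (π ⟨$⟩ʳ_))
  fromCoordₚ v = Sᴷ.unshear v ∘ (π ⟨$⟩ˡ_)
  fromCoordₗ m = Sᴷ.uncoshear m ∘ (π ⟨$⟩ˡ_)

  dot-coord : ∀ ℓ y → dot ℓ y ≈ dot (coordₗ ℓ) (coordₚ y)
  dot-coord ℓ y = trans (dot-permute π ℓ y) (Sᴷ.dot-shear W₂≈1 (ℓ ∘ (π ⟨$⟩ʳ_)) (y ∘ (π ⟨$⟩ʳ_)))

  private
    at-inverseˡ : ∀ (v : Fin 3 → Carrier) i → v (π ⟨$⟩ˡ (π ⟨$⟩ʳ i)) ≈ v i
    at-inverseˡ v i = reflexive (≡.cong v (inverseˡ π))

    at-inverseʳ : ∀ (v : Fin 3 → Carrier) i → v (π ⟨$⟩ʳ (π ⟨$⟩ˡ i)) ≈ v i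
    at-inverseʳ v i = reflexive (≡.cong v (inverseʳ π))

  coordₚ-fromCoordₚ : ∀ v i → coordₚ (fromCoordₚ v) i ≈ v i
  coordₚ-fromCoordₚ v i = trans (Sᴷ.shear-cong (at-inverseˡ (Sᴷ.unshear v)) i) (Sᴷ.shear-unshear v i)

  coordₗ-fromCoordₗ : ∀ m i → coordₗ (fromCoordₗ m) i ≈ m i
  coordₗ-fromCoordₗ m i = trans (Sᴷ.coshear-cong (at-inverseˡ (Sᴷ.uncoshear m)) i) (Sᴷ.coshear-uncoshear W₂≈1 m i)

  dot-fromCoordₗ : ∀ m y → dot (fromCoordₗ m) y ≈ dot m (coordₚ y)
  dot-fromCoordₗ m y = trans (dot-coord (fromCoordₗ m) y) (dot-cong {b = coordₚ y} (coordₗ-fromCoordₗ m) (λ _ → refl))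

  coordₚ-reflects-zero : ∀ {y} → (∀ i → coordₚ y i ≈ 0#) → ∀ i → y i ≈ 0#
  coordₚ-reflects-zero {y} y′≈0 i = begin
    y i                                     ≈⟨ at-inverseʳ y i ⟨
    y (π ⟨$⟩ʳ (π ⟨$⟩ˡ i))                   ≈⟨ Sᴷ.shear-kernel W₂≈1 {y ∘ (π ⟨$⟩ʳ_)} (y′≈0 0F) (y′≈0 1F) (π ⟨$⟩ˡ i) ⟩
    y (π ⟨$⟩ʳ 2F) * W (π ⟨$⟩ˡ i)            ≈⟨ *-congʳ (y′≈0 2F) ⟩
    0# * W (π ⟨$⟩ˡ i)                       ≈⟨ zeroˡ _ ⟩
    0#                                      ∎

  coordₗ-reflects-zero : ∀ {ℓ} → (∀ i → coordₗ ℓ i ≈ 0#) → ∀ i → ℓ i ≈ 0#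
  coordₗ-reflects-zero {ℓ} ℓ′≈0 i = trans (sym (at-inverseʳ ℓ i)) (Sᴷ.coshear-reflects-zero W₂≈1 {ℓ ∘ (π ⟨$⟩ʳ_)} ℓ′≈0 (π ⟨$⟩ˡ i))

  fromCoordₚ-reflects-zero : ∀ {v} → (∀ i → fromCoordₚ v i ≈ 0#) → ∀ i → v i ≈ 0#
  fromCoordₚ-reflects-zero {v} v′≈0 = Sᴷ.unshear-reflects-zero (λ i → trans (sym (at-inverseˡ (Sᴷ.unshear v) i)) (v′≈0 (π ⟨$⟩ʳ i)))

  fromCoordₗ-reflects-zero : ∀ {m} → (∀ i → fromCoordₗ m i ≈ 0#) → ∀ i → m i ≈ 0#
  fromCoordₗ-reflects-zero {m} m′≈0 = Sᴷ.uncoshear-reflects-zero (λ i → trans (sym (at-inverseˡ (Sᴷ.uncoshear m) i)) (m′≈0 (π ⟨$⟩ʳ i)))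

  cD : Carrier
  cD = c₀ * ι (w j)

  private
    permute-D : ∀ i → proj₁ D (π ⟨$⟩ʳ i) ≈ cD * W i
    permute-D i = begin
      proj₁ D (π ⟨$⟩ʳ i)               ≈⟨ D≈c₀w (π ⟨$⟩ʳ i) ⟩
      c₀ * ι (w (π ⟨$⟩ʳ i))            ≈⟨ *-congˡ (ι.⟦⟧-cong w≈w′wⱼ) ⟩
      c₀ * ι (w′ i F.* w j)            ≈⟨ *-congˡ (ι.*-homo (w′ i) (w j)) ⟩
      c₀ * (W i * ι (w j))             ≈⟨ solve 3 (λ c a b → c :* (a :* b) := (c :* b) :* a) refl c₀ (W i) (ι (w j)) ⟩
      cD * W i                         ∎
      where
      w≈w′wⱼ : w (π ⟨$⟩ʳ i) F.≈ w′ i F.* w j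
      w≈w′wⱼ = F.sym (F.trans (F.*-assoc _ _ _) (F.trans (F.*-congˡ (F.trans (F.*-comm _ _)
                 (proj₂ (FF.division F.1# (proj₂ w≉0))))) (F.*-identityʳ _)))

  coordₚ-D : ∀ i → coordₚ (proj₁ D) i ≈ (0# ∷ 0# ∷ cD ∷ []) i
  coordₚ-D i = trans (Sᴷ.shear-scale cD permute-D i) (trans (*-congˡ (Sᴷ.shear-W W₂≈1 i)) (scaled i))
    where
    scaled : ∀ i → cD * (0# ∷ 0# ∷ 1# ∷ []) i ≈ (0# ∷ 0# ∷ cD ∷ []) i
    scaled 0F = zeroʳ cD
    scaled 1F = zeroʳ cD
    scaled 2F = *-identityʳ cD

  cD≉0 : ¬ cD ≈ 0#
  cD≉0 cD≈0 = proj₂ D λ i → begin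
    proj₁ D i                          ≈⟨ at-inverseʳ (proj₁ D) i ⟨
    proj₁ D (π ⟨$⟩ʳ (π ⟨$⟩ˡ i))        ≈⟨ permute-D (π ⟨$⟩ˡ i) ⟩
    cD * W (π ⟨$⟩ˡ i)                  ≈⟨ *-congʳ cD≈0 ⟩
    0# * W (π ⟨$⟩ˡ i)                  ≈⟨ zeroˡ _ ⟩
    0#                                 ∎

  dot-D : ∀ ℓ → dot ℓ (proj₁ D) ≈ coordₗ ℓ 2F * cD
  dot-D ℓ = begin
    dot ℓ (proj₁ D)                             ≈⟨ dot-coord ℓ (proj₁ D) ⟩
    dot (coordₗ ℓ) (coordₚ (proj₁ D))           ≈⟨ dot-cong {a = coordₗ ℓ} {b = coordₚ (proj₁ D)} (λ _ → refl) coordₚ-D ⟩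
    dot (coordₗ ℓ) (0# ∷ 0# ∷ cD ∷ [])
      ≈⟨ solve 4 (λ a b c d → a :* con (+ 0) :+ (b :* con (+ 0) :+ c :* d) := c :* d) refl
               (coordₗ ℓ 0F) (coordₗ ℓ 1F) (coordₗ ℓ 2F) cD ⟩
    coordₗ ℓ 2F * cD                            ∎

  ∼D⇔ : ∀ (x : Point) → x ∼ D ⇔ (coordₚ (proj₁ x) 0F ≈ 0# × coordₚ (proj₁ x) 1F ≈ 0#)
  ∼D⇔ (x , x≢0) = mk⇔ to from
    where
    to : (x , x≢0) ∼ D → coordₚ x 0F ≈ 0# × coordₚ x 1F ≈ 0#
    to (s , x≈sD) = trans (scaled 0F) (zeroʳ s) , trans (scaled 1F) (zeroʳ s)
      where
      scaled : ∀ i → coordₚ x i ≈ s * (0# ∷ 0# ∷ cD ∷ []) i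
      scaled i = trans (Sᴷ.shear-scale s (λ i → x≈sD (π ⟨$⟩ʳ i)) i) (*-congˡ (coordₚ-D i))
    from : coordₚ x 0F ≈ 0# × coordₚ x 1F ≈ 0# → (x , x≢0) ∼ D
    from (x′₀≈0 , x′₁≈0) = z , λ i → begin
      x i                                  ≈⟨ at-inverseʳ x i ⟨
      x (π ⟨$⟩ʳ (π ⟨$⟩ˡ i))                ≈⟨ Sᴷ.shear-kernel W₂≈1 {x ∘ (π ⟨$⟩ʳ_)} x′₀≈0 x′₁≈0 (π ⟨$⟩ˡ i) ⟩
      x (π ⟨$⟩ʳ 2F) * W (π ⟨$⟩ˡ i)         ≈⟨ *-congʳ (proj₂ z-spec) ⟨
      (cD * z) * W (π ⟨$⟩ˡ i)              ≈⟨ solve 3 (λ c z w → (c :* z) :* w := z :* (c :* w)) refl cD z (W (π ⟨$⟩ˡ i)) ⟩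
      z * (cD * W (π ⟨$⟩ˡ i))              ≈⟨ *-congˡ (permute-D (π ⟨$⟩ˡ i)) ⟨
      z * proj₁ D (π ⟨$⟩ʳ (π ⟨$⟩ˡ i))      ≈⟨ *-congˡ (at-inverseʳ (proj₁ D) i) ⟩
      z * proj₁ D i                        ∎
      where
      z-spec = KF.division (x (π ⟨$⟩ʳ 2F)) cD≉0
      z = proj₁ z-spec

  private
    ι-sub-* : ∀ a b c → ι (a F.- b F.* c) ≈ ι a - ι b * ι c
    ι-sub-* a b c = trans (ι.+-homo _ _) (+-congˡ (trans (ι.-‿homo _) (-‿cong (ι.*-homo b c))))

    ι-shear : ∀ u i → Sᴷ.shear (ι ∘ u) i ≈ ι (Sᶠ.shear u i)
    ι-shear u 0F = sym (ι-sub-* (u 0F) (u 2F) (w′ 0F))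
    ι-shear u 1F = sym (ι-sub-* (u 1F) (u 2F) (w′ 1F))
    ι-shear u 2F = refl

  RationalMultiple : Carrier → Carrier → Set
  RationalMultiple x y = ∃[ c ] ∃[ a ] ∃[ b ] (¬ c ≈ 0# × FF.NotBothZero a b × x ≈ c * ι a × y ≈ c * ι b)

  subplane-direction : ∀ (p : Point) → InSubplane p → ¬ p ∼ D →
    RationalMultiple (coordₚ (proj₁ p) 0F) (coordₚ (proj₁ p) 1F)
  subplane-direction (p , p≢0) (u , c , p≈cu) p≁D = c , a , b , c≉0 , ab≉0 , p′≈ 0F , p′≈ 1F
    where
    u′ : Fin 3 → F.Carrier
    u′ = Sᶠ.shear (u ∘ (π ⟨$⟩ʳ_))
    a = u′ 0F
    b = u′ 1F
    p′≈ : ∀ i → coordₚ p i ≈ c * ι (u′ i)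
    p′≈ i = trans (Sᴷ.shear-scale c (λ i → p≈cu (π ⟨$⟩ʳ i)) i) (*-congˡ (ι-shear (u ∘ (π ⟨$⟩ʳ_)) i))
    c≉0 : ¬ c ≈ 0#
    c≉0 c≈0 = p≢0 (λ i → trans (p≈cu i) (trans (*-congʳ c≈0) (zeroˡ _)))
    vanish : ∀ {x y} → x F.≈ F.0# → y ≈ c * ι x → y ≈ 0#
    vanish x≈0 y≈cx = trans y≈cx (trans (*-congˡ (trans (ι.⟦⟧-cong x≈0) ι.0#-homo)) (zeroʳ c))
    ab≉0 : FF.NotBothZero a b
    ab≉0 (a≈0 , b≈0) = p≁D (Equivalence.from (∼D⇔ (p , p≢0)) (vanish a≈0 (p′≈ 0F) , vanish b≈0 (p′≈ 1F)))

  rational-direction∈π : ∀ α β nz → InSubplane (fromCoordₚ (ι α ∷ ι β ∷ 0# ∷ []) , nz)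
  rational-direction∈π α β nz = (λ i → (α ∷ β ∷ F.0# ∷ []) (π ⟨$⟩ˡ i)) , 1# , λ i → rational (π ⟨$⟩ˡ i)
    where
    rational : ∀ k → Sᴷ.unshear (ι α ∷ ι β ∷ 0# ∷ []) k ≈ 1# * ι ((α ∷ β ∷ F.0# ∷ []) k)
    rational 0F = trans (trans (+-congˡ (zeroˡ _)) (+-identityʳ _)) (sym (*-identityˡ _))
    rational 1F = trans (trans (+-congˡ (zeroˡ _)) (+-identityʳ _)) (sym (*-identityˡ _))
    rational 2F = sym (trans (*-identityˡ _) ι.0#-homo)

module OrdinaryLines (F K : CommutativeRing 0ℓ 0ℓ) (isFieldF : IsField F) (isFieldK : IsField K)
  (_≟F_ : Decidable (CommutativeRing._≈_ F)) (_≟K_ : Decidable (CommutativeRing._≈_ K))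
  (ι : CommutativeRing.Carrier F → CommutativeRing.Carrier K) (ι-monomorphism : IsFieldEmbedding F K ι)
  (D : PG2.Point K) (D∈π : Rectangle.InSubplane F K ι D D) where

  private
    module F = CommutativeRing F
    module ι = RingMorphisms.IsRingMonomorphism ι-monomorphism
    module FF = FieldProperties F isFieldF _≟F_
    module KF = FieldProperties K isFieldK _≟K_
  open CommutativeRing K hiding (zero)
  open import Algebra.Properties.Ring ring using (-‿injective; -0#≈0#; x∙y⁻¹≈ε⇒x≈y)
  open PG2 K
  open PG2Properties K
  open Rectangle F K ι D
  open Frame F K isFieldF isFieldK _≟F_ _≟K_ ι ι-monomorphism D D∈π
  open IntegerSolver K
  open SetoidReasoning setoid

  RationalDirection : Carrier → Carrier → Set
  RationalDirection x y = ∃[ α ] ∃[ β ] (FF.NotBothZero α β × ι β * x ≈ ι α * y)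

  ι-NotBothZero : ∀ {α β} → FF.NotBothZero α β → KF.NotBothZero (ι α) (ι β)
  ι-NotBothZero αβ≉0 (ια≈0 , ιβ≈0) = αβ≉0 (ι-reflects-zero ια≈0 , ι-reflects-zero ιβ≈0)
    where ι-reflects-zero : ∀ {a} → ι a ≈ 0# → a F.≈ F.0#
          ι-reflects-zero ιa≈0 = ι.injective (trans ιa≈0 (sym ι.0#-homo))

  dot-through-D : ∀ ℓ y → coordₗ ℓ 2F ≈ 0# → dot ℓ y ≈ coordₗ ℓ 0F * coordₚ y 0F + coordₗ ℓ 1F * coordₚ y 1F
  dot-through-D ℓ y m₂≈0 = begin
    dot ℓ y                                  ≈⟨ dot-coord ℓ y ⟩
    m 0F * y′ 0F + (m 1F * y′ 1F + m 2F * y′ 2F) ≈⟨ +-congˡ (+-congˡ (trans (*-congʳ m₂≈0) (zeroˡ _))) ⟩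
    m 0F * y′ 0F + (m 1F * y′ 1F + 0#)       ≈⟨ +-congˡ (+-identityʳ _) ⟩
    m 0F * y′ 0F + m 1F * y′ 1F              ∎
    where m = coordₗ ℓ
          y′ = coordₚ y

  InP⇒rational : ∀ x → InP x → RationalDirection (coordₚ (proj₁ x) 0F) (coordₚ (proj₁ x) 1F)
  InP⇒rational (x , _) ((ℓ , ℓ≢0) , ((p , p≢0) , p∈π , p≁D , D∈ℓ , p∈ℓ) , x∈ℓ) =
    direction-of-x (subplane-direction (p , p≢0) p∈π p≁D)
    where
    m = coordₗ ℓ
    m₂≈0 : m 2F ≈ 0#
    m₂≈0 = KF.x*y≈0⇒y≈0 cD≉0 (trans (*-comm _ _) (trans (sym (dot-D ℓ)) D∈ℓ))
    m₀₁≉0 : KF.NotBothZero (m 0F) (m 1F)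
    m₀₁≉0 (m₀≈0 , m₁≈0) = ℓ≢0 (coordₗ-reflects-zero λ { 0F → m₀≈0 ; 1F → m₁≈0 ; 2F → m₂≈0 })
    direction-of-x : RationalMultiple (coordₚ p 0F) (coordₚ p 1F) →
                     RationalDirection (coordₚ x 0F) (coordₚ x 1F)
    direction-of-x (c , a , b , c≉0 , ab≉0 , p₀≈ca , p₁≈cb) =
      a , b , ab≉0 , KF.annihilated⇒proportional m₀₁≉0 m·ab≈0 (trans (sym (dot-through-D ℓ x m₂≈0)) x∈ℓ)
      where
      distribute : ∀ c m₀ m₁ a b → c * (m₀ * a + m₁ * b) ≈ m₀ * (c * a) + m₁ * (c * b)
      distribute = solve 5 (λ c m₀ m₁ a b → c :* (m₀ :* a :+ m₁ :* b) := m₀ :* (c :* a) :+ m₁ :* (c :* b)) refl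
      m·ab≈0 : m 0F * ι a + m 1F * ι b ≈ 0#
      m·ab≈0 = KF.x*y≈0⇒y≈0 c≉0 (begin
        c * (m 0F * ι a + m 1F * ι b)             ≈⟨ distribute c (m 0F) (m 1F) (ι a) (ι b) ⟩
        m 0F * (c * ι a) + m 1F * (c * ι b)       ≈⟨ +-cong (*-congˡ p₀≈ca) (*-congˡ p₁≈cb) ⟨
        m 0F * coordₚ p 0F + m 1F * coordₚ p 1F   ≈⟨ dot-through-D ℓ p m₂≈0 ⟨
        dot ℓ p                                   ≈⟨ p∈ℓ ⟩
        0#                                        ∎)

  rational⇒InP : ∀ x → RationalDirection (coordₚ (proj₁ x) 0F) (coordₚ (proj₁ x) 1F) → InP x
  rational⇒InP (x , _) (α , β , αβ≉0 , βX≈αY) =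
    (ℓ , ℓ≢0) , ((p , p≢0) , rational-direction∈π α β p≢0 , p≁D , D∈ℓ , p∈ℓ) , x∈ℓ
    where
    ιαβ≉0 = ι-NotBothZero αβ≉0
    m v : Fin 3 → Carrier
    m = ι β ∷ - ι α ∷ 0# ∷ []
    v = ι α ∷ ι β ∷ 0# ∷ []
    ℓ = fromCoordₗ m
    p = fromCoordₚ v
    ℓ≢0 : NonZeroVec ℓ
    ℓ≢0 ℓ≈0 = ιαβ≉0 (-‿injective (trans (m≈0 1F) (sym -0#≈0#)) , m≈0 0F)
      where m≈0 = fromCoordₗ-reflects-zero {m} ℓ≈0
    p≢0 : NonZeroVec p
    p≢0 p≈0 = ιαβ≉0 (v≈0 0F , v≈0 1F)
      where v≈0 = fromCoordₚ-reflects-zero {v} p≈0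
    p≁D : ¬ (p , p≢0) ∼ D
    p≁D p∼D = ιαβ≉0 (trans (sym (coordₚ-fromCoordₚ v 0F)) (proj₁ p′₀₁≈0) ,
                     trans (sym (coordₚ-fromCoordₚ v 1F)) (proj₂ p′₀₁≈0))
      where p′₀₁≈0 = Equivalence.to (∼D⇔ (p , p≢0)) p∼D
    D∈ℓ : dot ℓ (proj₁ D) ≈ 0#
    D∈ℓ = trans (dot-D ℓ) (trans (*-congʳ (coordₗ-fromCoordₗ m 2F)) (zeroˡ cD))
    p∈ℓ : dot ℓ p ≈ 0#
    p∈ℓ = begin
      dot ℓ p                    ≈⟨ dot-fromCoordₗ m p ⟩
      dot m (coordₚ p)           ≈⟨ dot-cong {a = m} (λ _ → refl) (coordₚ-fromCoordₚ v) ⟩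
      dot m v
        ≈⟨ solve 2 (λ a b → b :* a :+ ((:- a) :* b :+ con (+ 0) :* con (+ 0)) := con (+ 0)) refl (ι α) (ι β) ⟩
      0#                         ∎
    x∈ℓ : dot ℓ x ≈ 0#
    x∈ℓ = begin
      dot ℓ x                      ≈⟨ dot-fromCoordₗ m x ⟩
      dot m (coordₚ x)
        ≈⟨ solve 5 (λ a b X Y Z → b :* X :+ ((:- a) :* Y :+ con (+ 0) :* Z) := b :* X :- a :* Y)
                   refl (ι α) (ι β) (coordₚ x 0F) (coordₚ x 1F) (coordₚ x 2F) ⟩
      ι β * coordₚ x 0F - ι α * coordₚ x 1F ≈⟨ +-congʳ βX≈αY ⟩
      ι α * coordₚ x 1F - ι α * coordₚ x 1F ≈⟨ -‿inverseʳ _ ⟩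
      0#                           ∎

  coordᴼ : OLine → Fin 3 → Carrier
  coordᴼ A = coordₗ (proj₁ (proj₁ A))

  coordᴼ₂≉0 : ∀ A → ¬ coordᴼ A 2F ≈ 0#
  coordᴼ₂≉0 ((L , _) , D∉L) m₂≈0 = D∉L (trans (dot-D L) (trans (*-congʳ m₂≈0) (zeroˡ cD)))

  -- In the new coordinates an ordinary line A is Z + coeffX A · X + coeffY A · Y = 0.
  coeffX coeffY : OLine → Carrier
  coeffX A = proj₁ (KF.division (coordᴼ A 0F) (coordᴼ₂≉0 A))
  coeffY A = proj₁ (KF.division (coordᴼ A 1F) (coordᴼ₂≉0 A))

  affine : Carrier → Carrier → (Fin 3 → Carrier) → Carrier
  affine a b = dot (a ∷ b ∷ 1# ∷ [])

  affine-cong : ∀ {a a′ b b′} v → a ≈ a′ → b ≈ b′ → affine a b v ≈ affine a′ b′ v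
  affine-cong v a≈a′ b≈b′ = +-cong (*-congʳ a≈a′) (+-congʳ (*-congʳ b≈b′))

  incident⇔ : ∀ A (x : Point) → x I proj₁ A ⇔ affine (coeffX A) (coeffY A) (coordₚ (proj₁ x)) ≈ 0#
  incident⇔ A (x , _) = mk⇔
    (λ x∈A → KF.x*y≈0⇒y≈0 (coordᴼ₂≉0 A) (trans (sym scaled) x∈A))
    (λ x∈A′ → trans scaled (trans (*-congˡ x∈A′) (zeroʳ _)))
    where
    m = coordᴼ A
    a = coeffX A
    b = coeffY A
    x′ = coordₚ x
    scaled : dot (proj₁ (proj₁ A)) x ≈ m 2F * affine a b x′
    scaled = begin
      dot (proj₁ (proj₁ A)) x                         ≈⟨ dot-coord (proj₁ (proj₁ A)) x ⟩
      m 0F * x′ 0F + (m 1F * x′ 1F + m 2F * x′ 2F)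
        ≈⟨ +-cong (*-congʳ (proj₂ (KF.division (m 0F) (coordᴼ₂≉0 A))))
                  (+-congʳ (*-congʳ (proj₂ (KF.division (m 1F) (coordᴼ₂≉0 A))))) ⟨
      (m 2F * a) * x′ 0F + ((m 2F * b) * x′ 1F + m 2F * x′ 2F)
        ≈⟨ solve 6 (λ c a b X Y Z → (c :* a) :* X :+ ((c :* b) :* Y :+ c :* Z)
                                   := c :* (a :* X :+ (b :* Y :+ con (+ 1) :* Z)))
                   refl (m 2F) a b (x′ 0F) (x′ 1F) (x′ 2F) ⟩
      m 2F * affine a b x′                             ∎

  oline : Carrier → Carrier → OLine
  oline a b = (L , L≢0) , D∉L
    where
    L = fromCoordₗ (a ∷ b ∷ 1# ∷ [])
    L≢0 : NonZeroVec L
    L≢0 L≈0 = KF.1≉0 (fromCoordₗ-reflects-zero {a ∷ b ∷ 1# ∷ []} L≈0 2F)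
    D∉L : ¬ dot L (proj₁ D) ≈ 0#
    D∉L D∈L = cD≉0 (begin
      cD              ≈⟨ *-identityˡ cD ⟨
      1# * cD         ≈⟨ *-congʳ (coordₗ-fromCoordₗ (a ∷ b ∷ 1# ∷ []) 2F) ⟨
      coordₗ L 2F * cD ≈⟨ dot-D L ⟨
      dot L (proj₁ D) ≈⟨ D∈L ⟩
      0#              ∎)

  private
    coordᴼ-oline : ∀ a b i → coordᴼ (oline a b) i ≈ (a ∷ b ∷ 1# ∷ []) i
    coordᴼ-oline a b = coordₗ-fromCoordₗ (a ∷ b ∷ 1# ∷ [])

  coeffX-oline : ∀ a b → coeffX (oline a b) ≈ a
  coeffX-oline a b = begin
    coeffX (oline a b)                        ≈⟨ *-identityˡ _ ⟨
    1# * coeffX (oline a b)                   ≈⟨ *-congʳ (coordᴼ-oline a b 2F) ⟨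
    coordᴼ (oline a b) 2F * coeffX (oline a b) ≈⟨ proj₂ (KF.division _ (coordᴼ₂≉0 (oline a b))) ⟩
    coordᴼ (oline a b) 0F                     ≈⟨ coordᴼ-oline a b 0F ⟩
    a                                         ∎

  coeffY-oline : ∀ a b → coeffY (oline a b) ≈ b
  coeffY-oline a b = begin
    coeffY (oline a b)                        ≈⟨ *-identityˡ _ ⟨
    1# * coeffY (oline a b)                   ≈⟨ *-congʳ (coordᴼ-oline a b 2F) ⟨
    coordᴼ (oline a b) 2F * coeffY (oline a b) ≈⟨ proj₂ (KF.division _ (coordᴼ₂≉0 (oline a b))) ⟩
    coordᴼ (oline a b) 1F                     ≈⟨ coordᴼ-oline a b 1F ⟩
    b                                         ∎

  private
    probeCoords : OLine → F.Carrier → F.Carrier → Fin 3 → Carrier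
    probeCoords A α β = ι α ∷ ι β ∷ - (coeffX A * ι α + coeffY A * ι β) ∷ []

  -- The point of A on the line of 𝒮 through D in the F-rational direction (α : β).
  probe : OLine → ∀ α β → FF.NotBothZero α β → Point
  probe A α β αβ≉0 = fromCoordₚ (probeCoords A α β) , λ p≈0 →
    ι-NotBothZero αβ≉0 (fromCoordₚ-reflects-zero {probeCoords A α β} p≈0 0F ,
                        fromCoordₚ-reflects-zero {probeCoords A α β} p≈0 1F)

  probe∈P : ∀ A α β αβ≉0 → InP (probe A α β αβ≉0)
  probe∈P A α β αβ≉0 = rational⇒InP (probe A α β αβ≉0) (α , β , αβ≉0 , (begin
    ι β * coordₚ p 0F ≈⟨ *-congˡ (coordₚ-fromCoordₚ (probeCoords A α β) 0F) ⟩
    ι β * ι α         ≈⟨ *-comm _ _ ⟩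
    ι α * ι β         ≈⟨ *-congˡ (coordₚ-fromCoordₚ (probeCoords A α β) 1F) ⟨
    ι α * coordₚ p 1F ∎))
    where p = proj₁ (probe A α β αβ≉0)

  probe∈⇔ : ∀ A B α β αβ≉0 → probe A α β αβ≉0 I proj₁ B ⇔
            ι α * (coeffX A - coeffX B) + ι β * (coeffY A - coeffY B) ≈ 0#
  probe∈⇔ A B α β αβ≉0 = mk⇔
    (λ p∈B → -‿injective (trans (sym value) (trans (Equivalence.to (incident⇔ B p) p∈B) (sym -0#≈0#))))
    (λ rel → Equivalence.from (incident⇔ B p) (trans value (trans (-‿cong rel) -0#≈0#)))
    where
    p = probe A α β αβ≉0
    value : affine (coeffX B) (coeffY B) (coordₚ (proj₁ p))
            ≈ - (ι α * (coeffX A - coeffX B) + ι β * (coeffY A - coeffY B))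
    value = begin
      affine (coeffX B) (coeffY B) (coordₚ (proj₁ p))
        ≈⟨ dot-cong {a = coeffX B ∷ coeffY B ∷ 1# ∷ []} (λ _ → refl) (coordₚ-fromCoordₚ (probeCoords A α β)) ⟩
      affine (coeffX B) (coeffY B) (probeCoords A α β)
        ≈⟨ solve 6 (λ a′ b′ a b s t → a′ :* s :+ (b′ :* t :+ con (+ 1) :* (:- (a :* s :+ b :* t)))
                                     := :- (s :* (a :- a′) :+ t :* (b :- b′)))
                   refl (coeffX B) (coeffY B) (coeffX A) (coeffY A) (ι α) (ι β) ⟩
      - (ι α * (coeffX A - coeffX B) + ι β * (coeffY A - coeffY B)) ∎

  probe∈A : ∀ A α β αβ≉0 → probe A α β αβ≉0 I proj₁ A
  probe∈A A α β αβ≉0 = Equivalence.from (probe∈⇔ A A α β αβ≉0)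
    (solve 4 (λ s t a b → s :* (a :- a) :+ t :* (b :- b) := con (+ 0)) refl (ι α) (ι β) (coeffX A) (coeffY A))

  ≈O⇔ : ∀ A B → A ≈O B ⇔ (coeffX A ≈ coeffX B × coeffY A ≈ coeffY B)
  ≈O⇔ A B = mk⇔ to from
    where
    from : coeffX A ≈ coeffX B × coeffY A ≈ coeffY B → A ≈O B
    from (a≈a′ , b≈b′) x _ = mk⇔
      (λ x∈A → Equivalence.from (incident⇔ B x)
                 (trans (sym (affine-cong (coordₚ (proj₁ x)) a≈a′ b≈b′)) (Equivalence.to (incident⇔ A x) x∈A)))
      (λ x∈B → Equivalence.from (incident⇔ A x)
                 (trans (affine-cong (coordₚ (proj₁ x)) a≈a′ b≈b′) (Equivalence.to (incident⇔ B x) x∈B)))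
    1,0≉0 : FF.NotBothZero F.1# F.0#
    1,0≉0 (1≈0 , _) = FF.1≉0 1≈0
    0,1≉0 : FF.NotBothZero F.0# F.1#
    0,1≉0 (_ , 1≈0) = FF.1≉0 1≈0
    relation : A ≈O B → ∀ α β αβ≉0 → ι α * (coeffX A - coeffX B) + ι β * (coeffY A - coeffY B) ≈ 0#
    relation A≈B α β αβ≉0 = Equivalence.to (probe∈⇔ A B α β αβ≉0)
      (Equivalence.to (A≈B (probe A α β αβ≉0) (probe∈P A α β αβ≉0)) (probe∈A A α β αβ≉0))
    to : A ≈O B → coeffX A ≈ coeffX B × coeffY A ≈ coeffY B
    to A≈B = x∙y⁻¹≈ε⇒x≈y _ _ (trans (sym (ι1*x+ι0*y≈x _ _)) (relation A≈B F.1# F.0# 1,0≉0)) ,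
             x∙y⁻¹≈ε⇒x≈y _ _ (trans (sym (ι0*x+ι1*y≈y _ _)) (relation A≈B F.0# F.1# 0,1≉0))
      where
      ι1*x+ι0*y≈x : ∀ x y → ι F.1# * x + ι F.0# * y ≈ x
      ι1*x+ι0*y≈x x y = trans (+-cong (*-congʳ ι.1#-homo) (*-congʳ ι.0#-homo))
        (solve 2 (λ x y → con (+ 1) :* x :+ con (+ 0) :* y := x) refl x y)
      ι0*x+ι1*y≈y : ∀ x y → ι F.0# * x + ι F.1# * y ≈ y
      ι0*x+ι1*y≈y x y = trans (+-cong (*-congʳ ι.0#-homo) (*-congʳ ι.1#-homo))
        (solve 2 (λ x y → con (+ 0) :* x :+ con (+ 1) :* y := y) refl x y)

  F-dependent : Carrier → Carrier → Set
  F-dependent u v = ∃[ α ] ∃[ β ] (FF.NotBothZero α β × ι α * u + ι β * v ≈ 0#)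

  common-point⇒F-dependent : ∀ A B x → x I proj₁ A → x I proj₁ B →
    RationalDirection (coordₚ (proj₁ x) 0F) (coordₚ (proj₁ x) 1F) →
    F-dependent (coeffX A - coeffX B) (coeffY A - coeffY B)
  common-point⇒F-dependent A B x x∈A x∈B (α , β , αβ≉0 , βX≈αY) = α , β , αβ≉0 , (begin
    ι α * Δa + ι β * Δb   ≈⟨ +-congˡ (*-comm _ _) ⟩
    ι α * Δa + Δb * ι β   ≈⟨ +-congˡ (KF.annihilated⇒proportional XY≉0 X·Δ≈0 X·βα≈0) ⟩
    ι α * Δa + Δa * - ι α ≈⟨ solve 2 (λ a d → a :* d :+ d :* (:- a) := con (+ 0)) refl (ι α) Δa ⟩
    0#                    ∎)
    where
    Δa = coeffX A - coeffX B
    Δb = coeffY A - coeffY B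
    x′ = coordₚ (proj₁ x)
    onA = Equivalence.to (incident⇔ A x) x∈A
    onB = Equivalence.to (incident⇔ B x) x∈B
    X·Δ≈0 : x′ 0F * Δa + x′ 1F * Δb ≈ 0#
    X·Δ≈0 = begin
      x′ 0F * Δa + x′ 1F * Δb
        ≈⟨ solve 7 (λ a b a′ b′ X Y Z → X :* (a :- a′) :+ Y :* (b :- b′)
               := (a :* X :+ (b :* Y :+ con (+ 1) :* Z)) :- (a′ :* X :+ (b′ :* Y :+ con (+ 1) :* Z)))
               refl (coeffX A) (coeffY A) (coeffX B) (coeffY B) (x′ 0F) (x′ 1F) (x′ 2F) ⟩
      affine (coeffX A) (coeffY A) x′ - affine (coeffX B) (coeffY B) x′ ≈⟨ +-cong onA (-‿cong onB) ⟩
      0# - 0#                 ≈⟨ -‿inverseʳ 0# ⟩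
      0#                      ∎
    X·βα≈0 : x′ 0F * ι β + x′ 1F * - ι α ≈ 0#
    X·βα≈0 = begin
      x′ 0F * ι β + x′ 1F * - ι α
        ≈⟨ solve 4 (λ X Y a b → X :* b :+ Y :* (:- a) := b :* X :- a :* Y) refl (x′ 0F) (x′ 1F) (ι α) (ι β) ⟩
      ι β * x′ 0F - ι α * x′ 1F ≈⟨ +-congʳ βX≈αY ⟩
      ι α * x′ 1F - ι α * x′ 1F ≈⟨ -‿inverseʳ _ ⟩
      0#                      ∎
    XY≉0 : KF.NotBothZero (x′ 0F) (x′ 1F)
    XY≉0 (X≈0 , Y≈0) = proj₂ x (coordₚ-reflects-zero λ { 0F → X≈0 ; 1F → Y≈0 ; 2F → Z≈0 })
      where
      Z≈0 : x′ 2F ≈ 0#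
      Z≈0 = begin
        x′ 2F   ≈⟨ solve 3 (λ a b Z → Z := a :* con (+ 0) :+ (b :* con (+ 0) :+ con (+ 1) :* Z))
                           refl (coeffX A) (coeffY A) (x′ 2F) ⟩
        affine (coeffX A) (coeffY A) (0# ∷ 0# ∷ x′ 2F ∷ [])
          ≈⟨ dot-cong {a = coeffX A ∷ coeffY A ∷ 1# ∷ []} {b = x′} {b′ = 0# ∷ 0# ∷ x′ 2F ∷ []}
                     (λ _ → refl) (λ { 0F → X≈0 ; 1F → Y≈0 ; 2F → refl }) ⟨
        affine (coeffX A) (coeffY A) x′ ≈⟨ onA ⟩
        0#      ∎

  adjacent⇔ : ∀ A B → AdjO A B ⇔ (¬ A ≈O B × F-dependent (coeffX A - coeffX B) (coeffY A - coeffY B))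
  adjacent⇔ A B = mk⇔
    (λ (A≉B , x , x∈P , x∈A , x∈B) → A≉B , common-point⇒F-dependent A B x x∈A x∈B (InP⇒rational x x∈P))
    (λ (A≉B , α , β , αβ≉0 , rel) →
      A≉B , probe A α β αβ≉0 , probe∈P A α β αβ≉0 , probe∈A A α β αβ≉0 , Equivalence.from (probe∈⇔ A B α β αβ≉0) rel)

module Isomorphism (F K : CommutativeRing 0ℓ 0ℓ) (isFieldF : IsField F) (isFieldK : IsField K)
  {q k : ℕ} (cardF : HasCard F q) (cardK : HasCard K (q ^ k))
  (ι : CommutativeRing.Carrier F → CommutativeRing.Carrier K) (ι-monomorphism : IsFieldEmbedding F K ι)
  (D : PG2.Point K) (D∈π : Rectangle.InSubplane F K ι D D) where

  private
    module F = CommutativeRing F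
    module Fᶠ = FiniteSetoid cardF
    module Kᶠ = FiniteSetoid cardK
  open Algebra.Properties.Ring F.ring using (x∙y⁻¹≈ε⇒x≈y; x≈y⇒x∙y⁻¹≈ε)
  open Rectangle F K ι D
  open Bilinear F k
  open OrdinaryLines F K isFieldF isFieldK Fᶠ._≟_ Kᶠ._≟_ ι ι-monomorphism D D∈π
  open FiniteExtension F K isFieldF {q} {k} cardF cardK ι
    (RingMorphisms.IsRingMonomorphism.isRingHomomorphism ι-monomorphism)

  toMatrix : OLine → Mat
  toMatrix A = coordinates (coeffX A) ∷ coordinates (coeffY A) ∷ []

  ≈O⇔≈M : ∀ A B → A ≈O B ⇔ (∀ i j → toMatrix A i j F.≈ toMatrix B i j)
  ≈O⇔≈M A B = mk⇔
    (λ A≈B → let (a≈a′ , b≈b′) = Equivalence.to (≈O⇔ A B) A≈B in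
             λ { 0F → coordinates-cong a≈a′ ; 1F → coordinates-cong b≈b′ })
    (λ M≈N → Equivalence.from (≈O⇔ A B) (coordinates-injective (M≈N 0F) , coordinates-injective (M≈N 1F)))

  toMatrix-bijection : Bijection OSetoid MatSetoid
  toMatrix-bijection = record
    { to        = toMatrix
    ; cong      = λ {A} {B} → Equivalence.to (≈O⇔≈M A B)
    ; bijective = (λ {A} {B} → Equivalence.from (≈O⇔≈M A B)) , surjective
    }
    where
    surjective : ∀ M → Σ OLine λ A → ∀ {B} → B ≈O A → ∀ i j → toMatrix B i j F.≈ M i j
    surjective M = A , λ {B} B≈A → λ
      { 0F j → F.trans (Equivalence.to (≈O⇔≈M B A) B≈A 0F j)
                       (F.trans (coordinates-cong (coeffX-oline _ _) j) (coordinates-fromCoordinates (M 0F) j))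
      ; 1F j → F.trans (Equivalence.to (≈O⇔≈M B A) B≈A 1F j)
                       (F.trans (coordinates-cong (coeffY-oline _ _) j) (coordinates-fromCoordinates (M 1F) j)) }
      where A = oline (fromCoordinates (M 0F)) (fromCoordinates (M 1F))

  adjacency-preserved : ∀ A B → AdjO A B ⇔ AdjH (toMatrix A) (toMatrix B)
  adjacency-preserved A B = mk⇔
    (λ adj → let (A≉B , α , β , αβ≉0 , rel) = Equivalence.to (adjacent⇔ A B) adj in
      (λ Δ≈0 → A≉B (Equivalence.from (≈O⇔≈M A B) (λ i j → x∙y⁻¹≈ε⇒x≈y _ _ (Δ≈0 i j)))) ,
      α , β , αβ≉0 , Equivalence.to (coordinates-relation α β _ _ _ _) rel)
    (λ (M≉N , α , β , αβ≉0 , rel) → Equivalence.from (adjacent⇔ A B)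
      ((λ A≈B → M≉N (λ i j → x≈y⇒x∙y⁻¹≈ε (Equivalence.to (≈O⇔≈M A B) A≈B i j))) ,
       α , β , αβ≉0 , Equivalence.from (coordinates-relation α β _ _ _ _) rel))

theorem4p6 : (q k : ℕ) → IsPrimePower q → 1 < k →
    (F K : CommutativeRing 0ℓ 0ℓ) → IsField F → IsField K →
    HasCard F q → HasCard K (q ^ k) →
    (ι : CommutativeRing.Carrier F → CommutativeRing.Carrier K) → IsFieldEmbedding F K ι →
    (D : PG2.Point K) → Rectangle.InSubplane F K ι D D →
    Σ (Bijection (Rectangle.OSetoid F K ι D) (Bilinear.MatSetoid F k))
      (λ φ → ∀ A B → Rectangle.AdjO F K ι D A B
                     ⇔ Bilinear.AdjH F k (Bijection.to φ A) (Bijection.to φ B))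
theorem4p6 q k _ _ F K isFieldF isFieldK cardF cardK ι ι-monomorphism D D∈π =
  toMatrix-bijection , adjacency-preserved
  where open Isomorphism F K isFieldF isFieldK {q} {k} cardF cardK ι ι-monomorphism D D∈π
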